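{- Let $m\geq 3$ and let $\Gamma$ be a cubic bipartite graph of order $2m$ (not necessarily connected). Then there exist a symmetric configuration $\mathcal{X}$ on $3m$ points with strong chromatic number $3$, and a strong $3$-colouring of $\mathcal{X}$ with colour classes $V_1,V_2,V_3$, such that the subgraph of the associated graph of $\mathcal{X}$ induced by $V_1\cup V_2$ is isomorphic to $\Gamma$.
   Context: A symmetric configuration $v_3$ is a finite incidence structure consisting of a set $V$ of $v$ points and a collection of $v$ blocks, each block a $3$-element subset of $V$, such that each point lies in exactly $3$ blocks and any two distinct points lie together in at most one block. Its associated graph has vertex set $V$, two points being adjacent iff they lie in a common block. A strong colouring is an assignment of colours to points such that the three points of every block receive three distinct colours (equivalently, a proper colouring of the associated graph); the strong chromatic number $\chi_s$ is the minimum number of colours in a strong colouring. -}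

module Defs where

open import Data.Nat using (ℕ; zero; suc; _+_; _<_)
open import Data.Bool using (Bool; true; false)
open import Data.Fin using (Fin; zero; suc)
open import Data.Product using (Σ; ∃; _×_; _,_)
open import Relation.Binary.PropositionalEquality using (_≡_; _≢_)
open import Relation.Nullary using (¬_)
open import Function.Bundles using (_⇔_)
open import Function.Definitions using (Injective)

card : ∀ {n} → (Fin n → Bool) → ℕ
card {zero}  P = 0
card {suc n} P with P zero
... | true  = suc (card (λ i → P (suc i)))
... | false = card (λ i → P (suc i))

-- Symmetric configurations v_3.
-- Points are Fin v, blocks are indexed by Fin v; the incidence
-- "point p lies on block b" is  inc p b ≡ true.

record Config (v : ℕ) : Set where
  field
    inc : Fin v → Fin v → Bool
    block-size : ∀ b → card (λ p → inc p b) ≡ 3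
    point-deg  : ∀ p → card (λ b → inc p b) ≡ 3
    pair-once  : ∀ p q → p ≢ q → ∀ b b' →
                 inc p b ≡ true → inc q b ≡ true →
                 inc p b' ≡ true → inc q b' ≡ true → b ≡ b'
open Config public

Adj : ∀ {v} → Config v → Fin v → Fin v → Set
Adj X p q = p ≢ q × ∃ λ b → inc X p b ≡ true × inc X q b ≡ true

StrongColouring : ∀ {v} → Config v → (k : ℕ) → (Fin v → Fin k) → Set
StrongColouring X k c = ∀ p q → Adj X p q → c p ≢ c q

StrongChromatic : ∀ {v} → Config v → ℕ → Set
StrongChromatic {v} X k =
  (∃ λ (c : Fin v → Fin k) → StrongColouring X k c) ×
  (∀ j → j < k → ¬ (∃ λ (c : Fin v → Fin j) → StrongColouring X j c))

record Graph (n : ℕ) : Set where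
  field
    E     : Fin n → Fin n → Bool
    sym   : ∀ x y → E x y ≡ E y x
    irrefl : ∀ x → E x x ≡ false
open Graph public

Cubic : ∀ {n} → Graph n → Set
Cubic G = ∀ x → card (E G x) ≡ 3

Bipartite : ∀ {n} → Graph n → Set
Bipartite {n} G = ∃ λ (s : Fin n → Fin 2) → ∀ x y → E G x y ≡ true → s x ≢ s y

IsoToInduced : ∀ {n v} → Graph n → (X : Config v) → (Fin v → Set) → Set
IsoToInduced {n} {v} Γ X S =
  Σ (Fin n → Fin v) λ f →
    Injective _≡_ _≡_ f ×
    (∀ x → S (f x)) ×
    (∀ p → S p → ∃ λ x → f x ≡ p) ×
    (∀ x y → (E Γ x y ≡ true) ⇔ Adj X (f x) (f y))

-- A configuration as required amounts to a partition of the 3m edges of Γ into m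
-- matchings of three edges each: the blocks are the edges of the k-th matching,
-- each extended by a new point k. The vertices are coloured by their side in Γ and
-- the new points by the third colour; every block is a triangle, so three colours
-- are also necessary. The partition comes from a proper edge colouring of Γ with m
-- colours (König: insert the edges one at a time, swapping the two colours along an
-- alternating path when the free colours at the ends differ), balanced afterwards
-- (de Werra): while a colour α has more than three edges and β fewer, an alternating
-- α/β-path with one more α-edge exists, and swapping it moves one edge from α to β.
module Submission where

open import Defs hiding (sym)
open import Data.Bool using (Bool; true; false; not; _∧_; if_then_else_)
open import Data.Bool.Properties using (∧-comm; ∧-identityʳ; ∧-zeroʳ) renaming (_≟_ to _≟ᵇ_)
open import Data.Empty using (⊥-elim)
open import Data.Fin using (Fin; zero; suc; toℕ; fromℕ<; inject₁; opposite; splitAt; join; combine; remQuot)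
open import Data.Fin.Permutation.Components using (transpose; transpose-inverse)
open import Data.Fin.Properties
  using (_≟_; any?; suc-injective; injective⇒≤; toℕ<n; toℕ-fromℕ<; pigeonhole; <⇒≢;
         splitAt-join; join-splitAt; remQuot-combine; combine-remQuot; combine-injective)
open import Data.List using (List; []; _∷_; allFin; cartesianProduct)
open import Data.List.Membership.Propositional using (_∈_)
open import Data.List.Membership.Propositional.Properties using (∈-allFin; ∈-cartesianProduct⁺)
open import Data.List.Relation.Unary.Any using (here; there)
open import Data.Maybe using (Maybe; just; nothing; _>>=_; is-just; fromMaybe)
open import Data.Maybe.Properties using (just-injective) renaming (≡-dec to ≡-decMaybe)
open import Data.Nat using (ℕ; zero; suc; _+_; _*_; _∸_; _≤_; _<_; _<?_; z≤n; s≤s)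
open import Data.Nat.Induction using (<-rec)
open import Data.Nat.Properties
  using (≤-refl; ≤-reflexive; ≤-trans; ≤-antisym; ≤-pred; <-irrefl; <-trans; <-cmp; ≮⇒≥; <⇒≱; n≤1+n;
         m≤n⇒m<n∨m≡n; +-identityˡ; +-identityʳ; +-suc; *-zeroʳ; +-mono-≤; +-mono-<-≤; +-mono-≤-<;
         +-cancelˡ-<; *-cancelʳ-≡; *-cancelˡ-≡; ∸-monoˡ-≤; m≤n⇒m∸n≡0; +-∸-assoc; +-*-semiring)
open import Algebra.Properties.Semiring.Sum +-*-semiring using (sum; sum-cong-≗; ∑-comm; *-distribʳ-sum)
open import Data.Product using (Σ; ∃; ∃₂; _×_; _,_; proj₁; proj₂; uncurry)
open import Data.Sum using (_⊎_; inj₁; inj₂)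
open import Data.Sum.Properties using (inj₂-injective)
open import Function.Bundles using (mk⇔)
open import Relation.Binary.Definitions using (tri<; tri≈; tri>)
open import Relation.Binary.PropositionalEquality
open import Relation.Nullary using (¬_; Dec; yes; no; does)
open import Relation.Nullary.Decidable using (dec-true; dec-false; _×-dec_; ¬?)

∧-true : ∀ {a b} → a ∧ b ≡ true → a ≡ true × b ≡ true
∧-true {true} {true} _ = refl , refl

not-true : ∀ {a} → not a ≡ true → a ≡ false
not-true {false} _ = refl

∧-swapʳ : ∀ a b c → (a ∧ b) ∧ c ≡ (a ∧ c) ∧ b
∧-swapʳ true b c = ∧-comm b c
∧-swapʳ false b c = refl

is-just-true : ∀ {A : Set} {m : Maybe A} → is-just m ≡ true → ∃ λ y → m ≡ just y
is-just-true {m = just y} _ = y , refl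

is-just-false : ∀ {A : Set} {m : Maybe A} → is-just m ≡ false → m ≡ nothing
is-just-false {m = nothing} _ = refl

just≢nothing : ∀ {A : Set} {x : A} {m : Maybe A} → m ≡ just x → m ≡ nothing → ∀ {B : Set} → B
just≢nothing refl ()

≟-true : ∀ {n} {a b : Fin n} → does (a ≟ b) ≡ true → a ≡ b
≟-true {a = a} {b} eq with a ≟ b
... | yes a≡b = a≡b

fin2-opposite : ∀ {s s′ : Fin 2} → s′ ≢ s → s′ ≡ opposite s
fin2-opposite {zero} {zero} s′≢s with () ← s′≢s refl
fin2-opposite {zero} {suc zero} _ = refl
fin2-opposite {suc zero} {zero} _ = refl
fin2-opposite {suc zero} {suc zero} s′≢s with () ← s′≢s refl

fin2-≢-≢ : ∀ {a b c : Fin 2} → a ≢ c → b ≢ c → a ≡ b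
fin2-≢-≢ a≢c b≢c = trans (fin2-opposite a≢c) (sym (fin2-opposite b≢c))

fin2-cover : ∀ (s r : Fin 2) → r ≡ s ⊎ r ≡ opposite s
fin2-cover s r with r ≟ s
... | yes r≡s = inj₁ r≡s
... | no r≢s = inj₂ (fin2-opposite r≢s)

-- Counting

record Enumeration {n} (P : Fin n → Bool) (k : ℕ) : Set where
  field
    enum : Fin k → Fin n
    enum-∈ : ∀ t → P (enum t) ≡ true
    enum-injective : ∀ t t′ → enum t ≡ enum t′ → t ≡ t′
    enum-surjective : ∀ x → P x ≡ true → ∃ λ t → enum t ≡ x

  index : ∀ x → P x ≡ true → Fin k
  index x px = proj₁ (enum-surjective x px)

  enum-index : ∀ x px → enum (index x px) ≡ x
  enum-index x px = proj₂ (enum-surjective x px)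

enumerate : ∀ {n} (P : Fin n → Bool) → Enumeration P (card P)
enumerate {zero} P = record
  { enum = λ () ; enum-∈ = λ () ; enum-injective = λ () ; enum-surjective = λ () }
enumerate {suc n} P with P zero in p₀ | enumerate (λ i → P (suc i))
... | true | E = record
  { enum = enum′ ; enum-∈ = enum′-∈ ; enum-injective = enum′-injective ; enum-surjective = enum′-surjective }
  where
  open Enumeration E
  enum′ : Fin (suc (card (λ i → P (suc i)))) → Fin (suc n)
  enum′ zero = zero
  enum′ (suc t) = suc (enum t)
  enum′-∈ : ∀ t → P (enum′ t) ≡ true
  enum′-∈ zero = p₀
  enum′-∈ (suc t) = enum-∈ t
  enum′-injective : ∀ t t′ → enum′ t ≡ enum′ t′ → t ≡ t′
  enum′-injective zero zero _ = refl
  enum′-injective (suc t) (suc t′) eq = cong suc (enum-injective t t′ (suc-injective eq))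
  enum′-surjective : ∀ x → P x ≡ true → ∃ λ t → enum′ t ≡ x
  enum′-surjective zero _ = zero , refl
  enum′-surjective (suc x) px = suc (index x px) , cong suc (enum-index x px)
... | false | E = record
  { enum = λ t → suc (enum t)
  ; enum-∈ = enum-∈
  ; enum-injective = λ t t′ eq → enum-injective t t′ (suc-injective eq)
  ; enum-surjective = enum′-surjective }
  where
  open Enumeration E
  enum′-surjective : ∀ x → P x ≡ true → ∃ λ t → suc (enum t) ≡ x
  enum′-surjective zero px with () ← trans (sym p₀) px
  enum′-surjective (suc x) px = index x px , cong suc (enum-index x px)

module _ {n n′} {P : Fin n → Bool} {Q : Fin n′ → Bool} (f : Fin n → Fin n′) where

  card-≤-injective : (∀ x → P x ≡ true → Q (f x) ≡ true) →
                     (∀ x x′ → P x ≡ true → P x′ ≡ true → f x ≡ f x′ → x ≡ x′) →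
                     card P ≤ card Q
  card-≤-injective into injective = injective⇒≤ {f = g} g-injective
    where
    open Enumeration (enumerate P) renaming (enum to eP; enum-∈ to eP-∈; enum-injective to eP-injective)
    module EQ = Enumeration (enumerate Q)
    g : Fin (card P) → Fin (card Q)
    g t = EQ.index (f (eP t)) (into (eP t) (eP-∈ t))
    g-injective : ∀ {t t′} → g t ≡ g t′ → t ≡ t′
    g-injective {t} {t′} eq = eP-injective t t′ (injective (eP t) (eP t′) (eP-∈ t) (eP-∈ t′)
      (trans (sym (EQ.enum-index _ _)) (trans (cong EQ.enum eq) (EQ.enum-index _ _))))

  card-≤-surjective : (∀ y → Q y ≡ true → ∃ λ x → P x ≡ true × f x ≡ y) → card Q ≤ card P
  card-≤-surjective surjective = injective⇒≤ {f = g} g-injective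
    where
    open Enumeration (enumerate Q) renaming (enum to eQ; enum-∈ to eQ-∈; enum-injective to eQ-injective)
    module EP = Enumeration (enumerate P)
    preimage : Fin (card Q) → Fin n
    preimage t = proj₁ (surjective (eQ t) (eQ-∈ t))
    g : Fin (card Q) → Fin (card P)
    g t = EP.index (preimage t) (proj₁ (proj₂ (surjective (eQ t) (eQ-∈ t))))
    f-preimage : ∀ t → f (preimage t) ≡ eQ t
    f-preimage t = proj₂ (proj₂ (surjective (eQ t) (eQ-∈ t)))
    g-injective : ∀ {t t′} → g t ≡ g t′ → t ≡ t′
    g-injective {t} {t′} eq = eQ-injective t t′ (begin
      eQ t              ≡⟨ sym (f-preimage t) ⟩
      f (preimage t)    ≡⟨ cong f (sym (EP.enum-index _ _)) ⟩
      f (EP.enum (g t)) ≡⟨ cong (λ i → f (EP.enum i)) eq ⟩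
      f (EP.enum (g t′)) ≡⟨ cong f (EP.enum-index _ _) ⟩
      f (preimage t′)   ≡⟨ f-preimage t′ ⟩
      eQ t′             ∎)
      where open ≡-Reasoning

  card-≡-bijective : (∀ x → P x ≡ true → Q (f x) ≡ true) →
                     (∀ x x′ → P x ≡ true → P x′ ≡ true → f x ≡ f x′ → x ≡ x′) →
                     (∀ y → Q y ≡ true → ∃ λ x → P x ≡ true × f x ≡ y) →
                     card P ≡ card Q
  card-≡-bijective into injective surjective =
    ≤-antisym (card-≤-injective into injective) (card-≤-surjective surjective)

card-suc : ∀ {n} (P : Fin (suc n) → Bool) → card P ≡ (if P zero then 1 else 0) + card (λ i → P (suc i))
card-suc P with P zero
... | true = refl
... | false = refl

card-cong : ∀ {n} {P Q : Fin n → Bool} → (∀ x → P x ≡ Q x) → card P ≡ card Q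
card-cong {zero} _ = refl
card-cong {suc n} {P} {Q} P≗Q = begin
  card P                                             ≡⟨ card-suc P ⟩
  (if P zero then 1 else 0) + card (λ i → P (suc i)) ≡⟨ cong₂ (λ b c → (if b then 1 else 0) + c) (P≗Q zero) (card-cong (λ i → P≗Q (suc i))) ⟩
  (if Q zero then 1 else 0) + card (λ i → Q (suc i)) ≡⟨ card-suc Q ⟨
  card Q                                             ∎
  where open ≡-Reasoning

card-differ-at : ∀ {n} {P Q : Fin n → Bool} x → (∀ y → y ≢ x → P y ≡ Q y) →
                 P x ≡ true → Q x ≡ false → card P ≡ suc (card Q)
card-differ-at {P = P} {Q} zero P≗Q px qx rewrite card-suc P | card-suc Q | px | qx =
  cong suc (card-cong (λ i → P≗Q (suc i) λ ()))
card-differ-at {P = P} {Q} (suc x) P≗Q px qx rewrite card-suc P | card-suc Q | P≗Q zero (λ ()) =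
  trans (cong (_ +_) (card-differ-at x (λ y y≢x → P≗Q (suc y) (λ eq → y≢x (suc-injective eq))) px qx))
        (+-suc _ _)

card-remove : ∀ {n} {P : Fin n → Bool} {x} → P x ≡ true → card P ≡ suc (card (λ y → P y ∧ not (does (y ≟ x))))
card-remove {P = P} {x} px = card-differ-at x agree px removed
  where
  agree : ∀ y → y ≢ x → P y ≡ (P y ∧ not (does (y ≟ x)))
  agree y y≢x rewrite dec-false (y ≟ x) y≢x = sym (∧-identityʳ (P y))
  removed : (P x ∧ not (does (x ≟ x))) ≡ false
  removed rewrite dec-true (x ≟ x) refl = ∧-zeroʳ (P x)

card-<⇒false : ∀ {n} (P : Fin n → Bool) → card P < n → ∃ λ x → P x ≡ false
card-<⇒false {suc n} P card<n with P zero in p₀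
... | false = zero , p₀
... | true = let (x , px) = card-<⇒false (λ i → P (suc i)) (≤-pred card<n) in suc x , px

card-∧-split : ∀ {n} (P Q : Fin n → Bool) → card P ≡ card (λ x → P x ∧ Q x) + card (λ x → P x ∧ not (Q x))
card-∧-split {zero} P Q = refl
card-∧-split {suc n} P Q with P zero | Q zero | card-∧-split (λ i → P (suc i)) (λ i → Q (suc i))
... | false | _ | split = split
... | true | true | split = cong suc split
... | true | false | split = trans (cong suc split) (sym (+-suc _ _))

card-not : ∀ {n} (P : Fin n → Bool) → card P + card (λ x → not (P x)) ≡ n
card-not {zero} P = refl
card-not {suc n} P with P zero | card-not (λ i → P (suc i))
... | true | count = cong suc count
... | false | count = trans (+-suc _ _) (cong suc count)

card-sum : ∀ {n} (P : Fin n → Bool) → card P ≡ sum (λ x → if P x then 1 else 0)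
card-sum {zero} P = refl
card-sum {suc n} P = trans (card-suc P) (cong ((if P zero then 1 else 0) +_) (card-sum (λ i → P (suc i))))

sum-const : ∀ n c → sum {n} (λ _ → c) ≡ n * c
sum-const zero c = refl
sum-const (suc n) c = cong (c +_) (sum-const n c)

sum-mono-≤ : ∀ {n} {f g : Fin n → ℕ} → (∀ i → f i ≤ g i) → sum f ≤ sum g
sum-mono-≤ {zero} _ = z≤n
sum-mono-≤ {suc n} f≤g = +-mono-≤ (f≤g zero) (sum-mono-≤ (λ i → f≤g (suc i)))

sum-mono-< : ∀ {n} {f g : Fin n → ℕ} → (∀ i → f i ≤ g i) → ∀ j → f j < g j → sum f < sum g
sum-mono-< f≤g zero fj<gj = +-mono-<-≤ fj<gj (sum-mono-≤ (λ i → f≤g (suc i)))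
sum-mono-< f≤g (suc j) fj<gj = +-mono-≤-< (f≤g zero) (sum-mono-< (λ i → f≤g (suc i)) j fj<gj)

sum-≤-tight : ∀ {n c} {f : Fin n → ℕ} → (∀ i → f i ≤ c) → sum f ≡ n * c → ∀ i → f i ≡ c
sum-≤-tight {n} {c} f≤c Σf i with m≤n⇒m<n∨m≡n (f≤c i)
... | inj₂ fi≡c = fi≡c
... | inj₁ fi<c = ⊥-elim (<-irrefl (trans Σf (sym (sum-const n c))) (sum-mono-< f≤c i fi<c))

const-<-sum : ∀ {n c} {f : Fin n → ℕ} → (∀ i → c ≤ f i) → ∀ j → c < f j → n * c < sum f
const-<-sum {n} {c} c≤f j c<fj = subst (_< _) (sum-const n c) (sum-mono-< c≤f j c<fj)

module _ {k} (α β : Fin k) where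

  transpose-ˡ : transpose α β α ≡ β
  transpose-ˡ rewrite dec-true (α ≟ α) refl = refl

  transpose-ʳ : transpose α β β ≡ α
  transpose-ʳ with β ≟ α
  ... | yes β≡α = β≡α
  ... | no _ rewrite dec-true (β ≟ β) refl = refl

  transpose-other : ∀ {γ} → γ ≢ α → γ ≢ β → transpose α β γ ≡ γ
  transpose-other {γ} γ≢α γ≢β rewrite dec-false (γ ≟ α) γ≢α | dec-false (γ ≟ β) γ≢β = refl

-- Edge colourings and alternating paths

-- mate x γ is the neighbour of x along its γ-edge, if any.
record EdgeColouring (n k : ℕ) (side : Fin n → Fin 2) : Set where
  field
    mate : Fin n → Fin k → Maybe (Fin n)
    mate-sym : ∀ {x y γ} → mate x γ ≡ just y → mate y γ ≡ just x
    mate-side : ∀ {x y γ} → mate x γ ≡ just y → side x ≢ side y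
    mate-injective : ∀ {x y γ δ} → mate x γ ≡ just y → mate x δ ≡ just y → γ ≡ δ

Linked : ∀ {n k side} → EdgeColouring n k side → Fin n → Fin n → Set
Linked C x y = ∃ λ γ → EdgeColouring.mate C x γ ≡ just y

-- The α/β-alternating path from u leaves vertices on side a along α and the other
-- vertices along β.
module AlternatingPath {n k side} (C : EdgeColouring n k side) (α β : Fin k) (a : Fin 2) where
  open EdgeColouring C

  forward backward : Fin n → Fin k
  forward x = if does (side x ≟ a) then α else β
  backward x = if does (side x ≟ a) then β else α

  module _ {x : Fin n} where
    forward-on : side x ≡ a → forward x ≡ α
    forward-on x∈a rewrite dec-true (side x ≟ a) x∈a = refl

    backward-on : side x ≡ a → backward x ≡ β
    backward-on x∈a rewrite dec-true (side x ≟ a) x∈a = refl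

    backward-off : side x ≢ a → backward x ≡ α
    backward-off x∉a rewrite dec-false (side x ≟ a) x∉a = refl

  forward-or-backward : ∀ x {γ} → γ ≡ α ⊎ γ ≡ β → γ ≡ forward x ⊎ γ ≡ backward x
  forward-or-backward x γ∈αβ with side x ≟ a | γ∈αβ
  ... | yes _ | inj₁ γ≡α = inj₁ γ≡α
  ... | yes _ | inj₂ γ≡β = inj₂ γ≡β
  ... | no _ | inj₁ γ≡α = inj₂ γ≡α
  ... | no _ | inj₂ γ≡β = inj₁ γ≡β

  backward-mate : ∀ {x y} → mate x (forward x) ≡ just y → backward y ≡ forward x
  backward-mate {x} {y} xy with side x ≟ a | side y ≟ a
  ... | yes x∈a | yes y∈a = ⊥-elim (mate-side xy (trans x∈a (sym y∈a)))
  ... | yes _ | no _ = refl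
  ... | no _ | yes _ = refl
  ... | no x∉a | no y∉a = ⊥-elim (mate-side xy (fin2-≢-≢ x∉a y∉a))

  walk : Fin n → ℕ → Maybe (Fin n)
  walk u zero = just u
  walk u (suc i) = walk u i >>= λ x → mate x (forward x)

  walk-step : ∀ u i {z} → walk u (suc i) ≡ just z → ∃ λ y → walk u i ≡ just y × mate y (forward y) ≡ just z
  walk-step u i w with walk u i
  ... | just y = y , refl , w

  walk-pred : ∀ u i {z} → walk u (suc i) ≡ just z → walk u i ≡ mate z (backward z)
  walk-pred u i w with walk-step u i w
  ... | y , wy , yz = trans wy (sym (subst (λ γ → mate _ γ ≡ just y) (sym (backward-mate yz)) (mate-sym yz)))

  walk-next : ∀ u i {y} → walk u i ≡ just y → walk u (suc i) ≡ mate y (forward y)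
  walk-next u i w rewrite w = refl

  -- The path is followed for at most n steps, which suffices by walk-bound below.
  follow : ℕ → ℕ → Fin n → ℕ × Fin n
  follow zero i z = i , z
  follow (suc fuel) i z with mate z (forward z)
  ... | nothing = i , z
  ... | just z′ = follow fuel (suc i) z′

  endIndex : Fin n → ℕ
  endIndex u = proj₁ (follow n 0 u)

  endVertex : Fin n → Fin n
  endVertex u = proj₂ (follow n 0 u)

  Start : Fin n → Set
  Start u = mate u (backward u) ≡ nothing

  -- Walking back from a common vertex, the predecessors agree; they cannot run past
  -- a start vertex, which has no backward edge.
  walks-meet : ∀ {u u′} → Start u → Start u′ → ∀ i j {z} →
               walk u i ≡ just z → walk u′ j ≡ just z → i ≡ j × u ≡ u′
  walks-meet _ _ zero zero refl refl = refl , refl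
  walks-meet {u} {u′} su su′ zero (suc j) refl w′ with walk-step u′ j w′
  ... | _ , wy , _ = just≢nothing wy (trans (walk-pred u′ j w′) su)
  walks-meet {u} {u′} su su′ (suc i) zero w refl with walk-step u i w
  ... | _ , wy , _ = just≢nothing wy (trans (walk-pred u i w) su′)
  walks-meet {u} {u′} su su′ (suc i) (suc j) w w′ with walk-step u i w
  ... | y , wy , _ with walks-meet su su′ i j wy (trans (walk-pred u′ j w′) (trans (sym (walk-pred u i w)) wy))
  ... | refl , u≡u′ = refl , u≡u′

  walk-down : ∀ u {i j z} → j ≤ i → walk u i ≡ just z → ∃ λ y → walk u j ≡ just y
  walk-down u j≤i w with m≤n⇒m<n∨m≡n j≤i
  ... | inj₂ refl = _ , w
  walk-down u {suc i} _ w | inj₁ (s≤s j≤i) = walk-down u j≤i (proj₁ (proj₂ (walk-step u i w)))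

  walk-bound : ∀ {u} → Start u → ∀ i {z} → walk u i ≡ just z → i < n
  walk-bound {u} su i w with n <? suc i
  ... | no n≮1+i = ≮⇒≥ n≮1+i
  ... | yes n<1+i with pigeonhole n<1+i (λ j → fromMaybe u (walk u (toℕ j)))
  ... | j , j′ , j<j′ , same with walk-down u (≤-pred (toℕ<n j)) w | walk-down u (≤-pred (toℕ<n j′)) w
  ... | y , wy | y′ , wy′ = ⊥-elim (<-irrefl (proj₁ (walks-meet su su (toℕ j) (toℕ j′) wy (trans wy′ (cong just (sym y≡y′))))) j<j′)
    where
    y≡y′ : y ≡ y′
    y≡y′ = trans (sym (cong (fromMaybe u) wy)) (trans same (cong (fromMaybe u) wy′))

  module FromStart {u} (u-start : Start u) where

    onPath? : ∀ x → Dec (∃ λ (i : Fin n) → walk u (toℕ i) ≡ just x)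
    onPath? x = any? (λ i → ≡-decMaybe _≟_ (walk u (toℕ i)) (just x))

    onPath : Fin n → Bool
    onPath x = does (onPath? x)

    onPath-intro : ∀ i {x} → walk u i ≡ just x → onPath x ≡ true
    onPath-intro i {x} w = dec-true (onPath? x) (fromℕ< i<n , subst (λ j → walk u j ≡ just x) (sym (toℕ-fromℕ< i<n)) w)
      where i<n = walk-bound u-start i w

    onPath-elim : ∀ {x} → onPath x ≡ true → ∃ λ i → walk u i ≡ just x
    onPath-elim {x} on with onPath? x
    ... | yes (i , w) = toℕ i , w

    start-onPath : onPath u ≡ true
    start-onPath = onPath-intro zero refl

    onPath-start : ∀ {x} → onPath x ≡ true → mate x (backward x) ≡ nothing → x ≡ u
    onPath-start on x-start with onPath-elim on
    ... | zero , refl = refl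
    ... | suc i , w = just≢nothing (proj₁ (proj₂ (walk-step u i w))) (trans (walk-pred u i w) x-start)

    onPath-closed : ∀ {x y γ} → onPath y ≡ true → mate y γ ≡ just x → γ ≡ α ⊎ γ ≡ β → onPath x ≡ true
    onPath-closed {x} {y} on yx γ∈αβ with onPath-elim on | forward-or-backward y γ∈αβ
    ... | i , w | inj₁ refl = onPath-intro (suc i) (trans (walk-next u i w) yx)
    ... | zero , refl | inj₂ refl = just≢nothing yx u-start
    ... | suc i , w | inj₂ refl = onPath-intro i (trans (walk-pred u i w) yx)

    onPath-mate : ∀ {x y γ} → onPath x ≡ false → mate y γ ≡ just x → γ ≡ α ⊎ γ ≡ β → onPath y ≡ false
    onPath-mate {y = y} off yx γ∈αβ with onPath y in on
    ... | false = refl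
    ... | true = trans (sym (onPath-closed on yx γ∈αβ)) off

    end-spec : walk u (endIndex u) ≡ just (endVertex u) × mate (endVertex u) (forward (endVertex u)) ≡ nothing
    end-spec = follow-spec n 0 refl (≤-reflexive (sym (+-identityˡ n)))
      where
      follow-spec : ∀ fuel i {z} → walk u i ≡ just z → n ≤ i + fuel →
                    walk u (proj₁ (follow fuel i z)) ≡ just (proj₂ (follow fuel i z)) ×
                    mate (proj₂ (follow fuel i z)) (forward (proj₂ (follow fuel i z))) ≡ nothing
      follow-spec zero i w n≤i = ⊥-elim (<⇒≱ (walk-bound u-start i w) (subst (n ≤_) (+-identityʳ i) n≤i))
      follow-spec (suc fuel) i {z} w n≤i with mate z (forward z) in stuck
      ... | nothing = w , stuck
      ... | just z′ = follow-spec fuel (suc i) (trans (walk-next u i w) stuck) (subst (n ≤_) (+-suc i fuel) n≤i)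

    end-reached : walk u (endIndex u) ≡ just (endVertex u)
    end-reached = proj₁ end-spec

    end-stuck : mate (endVertex u) (forward (endVertex u)) ≡ nothing
    end-stuck = proj₂ end-spec

    walk-beyond-end : ∀ j → endIndex u < j → walk u j ≡ nothing
    walk-beyond-end j L<j with walk u j in w
    ... | nothing = refl
    ... | just _ with walk-down u L<j w
    ... | _ , w′ = just≢nothing w′ (trans (walk-next u (endIndex u) end-reached) end-stuck)

    forward-before-end : ∀ j {z} → walk u j ≡ just z → z ≢ endVertex u → ∃ λ z′ → mate z (forward z) ≡ just z′
    forward-before-end j {z} w z≢e with <-cmp j (endIndex u)
    ... | tri< j<L _ _ = let (z′ , w′) = walk-down u j<L end-reached in z′ , trans (sym (walk-next u j w)) w′
    ... | tri≈ _ refl _ = ⊥-elim (z≢e (just-injective (trans (sym w) end-reached)))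
    ... | tri> _ _ L<j = just≢nothing w (walk-beyond-end j L<j)

    backward-at-end : ∀ {y} → mate u (forward u) ≡ just y → ∃ λ y′ → mate (endVertex u) (backward (endVertex u)) ≡ just y′
    backward-at-end uy = go (endIndex u) end-reached end-stuck
      where
      go : ∀ L {e} → walk u L ≡ just e → mate e (forward e) ≡ nothing → ∃ λ y′ → mate e (backward e) ≡ just y′
      go zero refl stuck₀ = just≢nothing uy stuck₀
      go (suc i) w _ = let (y′ , w′ , _) = walk-step u i w in y′ , trans (sym (walk-pred u i w)) w′

    σ : Fin k → Fin k
    σ = transpose α β

    σ-αβ : ∀ {γ} → γ ≡ α ⊎ γ ≡ β → σ γ ≡ α ⊎ σ γ ≡ β
    σ-αβ (inj₁ refl) = inj₂ (transpose-ˡ α β)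
    σ-αβ (inj₂ refl) = inj₁ (transpose-ʳ α β)

    αβ? : ∀ γ → (γ ≡ α ⊎ γ ≡ β) ⊎ (γ ≢ α × γ ≢ β)
    αβ? γ with γ ≟ α | γ ≟ β
    ... | yes γ≡α | _ = inj₁ (inj₁ γ≡α)
    ... | no _ | yes γ≡β = inj₁ (inj₂ γ≡β)
    ... | no γ≢α | no γ≢β = inj₂ (γ≢α , γ≢β)

    swapMate : Fin n → Fin k → Maybe (Fin n)
    swapMate x γ = if onPath x then mate x (σ γ) else mate x γ

    swapMate-on : ∀ {x} γ → onPath x ≡ true → swapMate x γ ≡ mate x (σ γ)
    swapMate-on γ on rewrite on = refl

    swapMate-off : ∀ {x} γ → onPath x ≡ false → swapMate x γ ≡ mate x γ
    swapMate-off γ off rewrite off = refl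

    swapMate-other : ∀ x {γ} → γ ≢ α → γ ≢ β → swapMate x γ ≡ mate x γ
    swapMate-other x {γ} γ≢α γ≢β with onPath x
    ... | true = cong (mate x) (transpose-other α β γ≢α γ≢β)
    ... | false = refl

    swapped-linked : ∀ {x y} → (∃ λ γ → swapMate x γ ≡ just y) → Linked C x y
    swapped-linked {x} (γ , xy) with onPath x
    ... | true = σ γ , xy
    ... | false = γ , xy

    linked-swapped : ∀ {x y} → Linked C x y → ∃ λ γ → swapMate x γ ≡ just y
    linked-swapped {x} (γ , xy) with onPath x
    ... | true = transpose β α γ , trans (cong (mate x) (transpose-inverse α β)) xy
    ... | false = γ , xy

    swapMate-sym : ∀ {x y γ} → swapMate x γ ≡ just y → swapMate y γ ≡ just x
    swapMate-sym {x} {y} {γ} xy with onPath x in on | αβ? γ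
    ... | true | inj₁ γ∈αβ = trans (swapMate-on γ (onPath-closed on xy (σ-αβ γ∈αβ))) (mate-sym xy)
    ... | false | inj₁ γ∈αβ = trans (swapMate-off γ (onPath-mate on (mate-sym xy) γ∈αβ)) (mate-sym xy)
    ... | true | inj₂ (γ≢α , γ≢β) = trans (swapMate-other y γ≢α γ≢β)
                                      (mate-sym (trans (cong (mate x) (sym (transpose-other α β γ≢α γ≢β))) xy))
    ... | false | inj₂ (γ≢α , γ≢β) = trans (swapMate-other y γ≢α γ≢β) (mate-sym xy)

    swapMate-injective : ∀ {x y γ δ} → swapMate x γ ≡ just y → swapMate x δ ≡ just y → γ ≡ δ
    swapMate-injective {x} {γ = γ} {δ} xy xy′ with onPath x
    ... | true = begin
      γ                       ≡⟨ sym (transpose-inverse β α) ⟩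
      transpose β α (σ γ)     ≡⟨ cong (transpose β α) (mate-injective xy xy′) ⟩
      transpose β α (σ δ)     ≡⟨ transpose-inverse β α ⟩
      δ                       ∎
      where open ≡-Reasoning
    ... | false = mate-injective xy xy′

    swapped : EdgeColouring n k side
    swapped = record
      { mate = swapMate
      ; mate-sym = swapMate-sym
      ; mate-side = λ xy → mate-side (proj₂ (swapped-linked (_ , xy)))
      ; mate-injective = swapMate-injective
      }

-- König's edge colouring theorem

module _ {n k side} (C : EdgeColouring n k side) where
  open EdgeColouring C

  linked? : ∀ x y → Dec (Linked C x y)
  linked? x y = any? (λ γ → ≡-decMaybe _≟_ (mate x γ) (just y))

  linked-sym : ∀ {x y} → Linked C x y → Linked C y x
  linked-sym (γ , xy) = γ , mate-sym xy

record ColouringOf {n} k (side : Fin n → Fin 2) (G : Fin n → Fin n → Bool) : Set where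
  field
    colouring : EdgeColouring n k side
    linked⇒edge : ∀ {x y} → Linked colouring x y → G x y ≡ true
    edge⇒linked : ∀ {x y} → G x y ≡ true → Linked colouring x y
  open EdgeColouring colouring public

module AddEdge {n k side} (C : EdgeColouring n k side) {u v} (u-v : side u ≢ side v)
               (unlinked : ¬ Linked C u v) {α} (u-free : EdgeColouring.mate C u α ≡ nothing)
               (v-free : EdgeColouring.mate C v α ≡ nothing) where
  open EdgeColouring C

  Joins : Fin n → Fin n → Set
  Joins x y = x ≡ u × y ≡ v ⊎ x ≡ v × y ≡ u

  mate⁺ : Fin n → Fin k → Maybe (Fin n)
  mate⁺ x γ with γ ≟ α | x ≟ u | x ≟ v
  ... | yes _ | yes _ | _ = just v
  ... | yes _ | no _ | yes _ = just u
  ... | _ | _ | _ = mate x γ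

  mate⁺-old : ∀ {x y γ} → mate x γ ≡ just y → mate⁺ x γ ≡ just y
  mate⁺-old {x} {γ = γ} xy with γ ≟ α | x ≟ u | x ≟ v
  ... | yes refl | yes refl | _ = just≢nothing xy u-free
  ... | yes refl | no _ | yes refl = just≢nothing xy v-free
  ... | yes _ | no _ | no _ = xy
  ... | no _ | _ | _ = xy

  mate⁺-new : ∀ {x y} → Joins x y → mate⁺ x α ≡ just y
  mate⁺-new {x} j with α ≟ α | x ≟ u | x ≟ v | j
  ... | no α≢α | _ | _ | _ = ⊥-elim (α≢α refl)
  ... | yes _ | yes _ | _ | inj₁ (_ , refl) = refl
  ... | yes _ | yes refl | _ | inj₂ (refl , _) = ⊥-elim (u-v refl)
  ... | yes _ | no x≢u | _ | inj₁ (x≡u , _) = ⊥-elim (x≢u x≡u)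
  ... | yes _ | no _ | yes _ | inj₂ (_ , refl) = refl
  ... | yes _ | no _ | no x≢v | inj₂ (x≡v , _) = ⊥-elim (x≢v x≡v)

  mate⁺-cases : ∀ {x y γ} → mate⁺ x γ ≡ just y → mate x γ ≡ just y ⊎ (γ ≡ α × Joins x y)
  mate⁺-cases {x} {γ = γ} xy with γ ≟ α | x ≟ u | x ≟ v
  ... | yes γ≡α | yes x≡u | _ = inj₂ (γ≡α , inj₁ (x≡u , sym (just-injective xy)))
  ... | yes γ≡α | no _ | yes x≡v = inj₂ (γ≡α , inj₂ (x≡v , sym (just-injective xy)))
  ... | yes _ | no _ | no _ = inj₁ xy
  ... | no _ | _ | _ = inj₁ xy

  joins-sym : ∀ {x y} → Joins x y → Joins y x
  joins-sym (inj₁ (x≡u , y≡v)) = inj₂ (y≡v , x≡u)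
  joins-sym (inj₂ (x≡v , y≡u)) = inj₁ (y≡u , x≡v)

  joins-unlinked : ∀ {x y γ} → Joins x y → mate x γ ≢ just y
  joins-unlinked (inj₁ (refl , refl)) xy = unlinked (_ , xy)
  joins-unlinked (inj₂ (refl , refl)) xy = unlinked (_ , mate-sym xy)

  colouring : EdgeColouring n k side
  colouring = record
    { mate = mate⁺
    ; mate-sym = λ {x} {y} {γ} xy → sym′ (mate⁺-cases {x} {y} {γ} xy)
    ; mate-side = λ {x} {y} {γ} xy → side′ (mate⁺-cases {x} {y} {γ} xy)
    ; mate-injective = λ {x} {y} {γ} {δ} xy xy′ → injective′ (mate⁺-cases {x} {y} {γ} xy) (mate⁺-cases {x} {y} {δ} xy′)
    }
    where
    sym′ : ∀ {x y γ} → mate x γ ≡ just y ⊎ (γ ≡ α × Joins x y) → mate⁺ y γ ≡ just x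
    sym′ (inj₁ xy) = mate⁺-old (mate-sym xy)
    sym′ (inj₂ (refl , j)) = mate⁺-new (joins-sym j)
    side′ : ∀ {x y γ} → mate x γ ≡ just y ⊎ (γ ≡ α × Joins x y) → side x ≢ side y
    side′ (inj₁ xy) = mate-side xy
    side′ (inj₂ (_ , inj₁ (refl , refl))) = u-v
    side′ (inj₂ (_ , inj₂ (refl , refl))) = λ eq → u-v (sym eq)
    injective′ : ∀ {x y γ δ} → mate x γ ≡ just y ⊎ (γ ≡ α × Joins x y) →
                 mate x δ ≡ just y ⊎ (δ ≡ α × Joins x y) → γ ≡ δ
    injective′ (inj₁ xy) (inj₁ xy′) = mate-injective xy xy′
    injective′ (inj₂ (refl , _)) (inj₂ (refl , _)) = refl
    injective′ (inj₁ xy) (inj₂ (_ , j)) = ⊥-elim (joins-unlinked j xy)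
    injective′ (inj₂ (_ , j)) (inj₁ xy′) = ⊥-elim (joins-unlinked j xy′)

  linked-colouring : ∀ {x y} → Linked C x y → Linked colouring x y
  linked-colouring (γ , xy) = γ , mate⁺-old xy

  colouring-linked : ∀ {x y} → Linked colouring x y → Linked C x y ⊎ Joins x y
  colouring-linked {x} {y} (γ , xy) with mate⁺-cases {x} {y} {γ} xy
  ... | inj₁ xy′ = inj₁ (γ , xy′)
  ... | inj₂ (_ , j) = inj₂ j

  u-linked-v : Linked colouring u v
  u-linked-v = α , mate⁺-new (inj₁ (refl , refl))

module König {n k} (G : Fin n → Fin n → Bool) (side : Fin n → Fin 2)
             (G-sym : ∀ x y → G x y ≡ G y x) (G-side : ∀ {x y} → G x y ≡ true → side x ≢ side y)
             (G-degree : ∀ x → card (G x) ≤ k) where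

  Within : EdgeColouring n k side → Set
  Within C = ∀ {x y} → Linked C x y → G x y ≡ true

  free-colour : ∀ C → Within C → ∀ {x w} → G x w ≡ true → ¬ Linked C x w →
                ∃ λ α → EdgeColouring.mate C x α ≡ nothing
  free-colour C within {x} {w} gxw unlinked =
    let (α , unused) = card-<⇒false used used-< in α , is-just-false unused
    where
    open EdgeColouring C
    used : Fin k → Bool
    used γ = is-just (mate x γ)
    others : Fin n → Bool
    others y = G x y ∧ not (does (y ≟ w))
    into-others : ∀ γ → used γ ≡ true → others (fromMaybe x (mate x γ)) ≡ true
    into-others γ _ with mate x γ in xy
    ... | just y rewrite within (γ , xy) | dec-false (y ≟ w) (λ { refl → unlinked (γ , xy) }) = refl
    injective : ∀ γ δ → used γ ≡ true → used δ ≡ true → fromMaybe x (mate x γ) ≡ fromMaybe x (mate x δ) → γ ≡ δ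
    injective γ δ _ _ eq with mate x γ in xy | mate x δ in xy′
    ... | just y | just y′ = mate-injective xy (trans xy′ (cong just (sym eq)))
    used-< : card used < k
    used-< = ≤-trans (s≤s (card-≤-injective {Q = others} (λ γ → fromMaybe x (mate x γ)) into-others injective))
                     (subst (_≤ k) (card-remove {P = G x} gxw) (G-degree x))

  -- Free colours α at u and β at v; swapping α and β on the alternating path from v
  -- frees α at v and, since that path cannot reach u, keeps it free at u.
  extend : ∀ C → Within C → ∀ {u v} → G u v ≡ true →
           Σ (EdgeColouring n k side) λ C′ →
             Within C′ × (∀ {x y} → Linked C x y → Linked C′ x y) × Linked C′ u v
  extend C within {u} {v} guv with linked? C u v
  ... | yes uv = C , within , (λ xy → xy) , uv
  ... | no unlinked with free-colour C within guv unlinked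
                      | free-colour C within (trans (G-sym v u) guv) (λ vu → unlinked (linked-sym C vu))
  ... | α , u-free | β , v-free = C⁺ , within⁺ , grow , AddEdge.u-linked-v C′ u-v unlinked′ u-free′ v-free′
    where
    open EdgeColouring C
    u-v : side u ≢ side v
    u-v = G-side guv
    open AlternatingPath C α β (side v)
    open FromStart (trans (cong (mate v) (backward-on refl)) v-free)
    C′ : EdgeColouring n k side
    C′ = swapped
    u-off : onPath u ≡ false
    u-off with onPath u in on
    ... | false = refl
    ... | true = ⊥-elim (u-v (cong side (onPath-start on (trans (cong (mate u) (backward-off u-v)) u-free))))
    u-free′ : swapMate u α ≡ nothing
    u-free′ = trans (swapMate-off α u-off) u-free
    v-free′ : swapMate v α ≡ nothing
    v-free′ = trans (swapMate-on α start-onPath) (trans (cong (mate v) (transpose-ˡ α β)) v-free)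
    unlinked′ : ¬ Linked C′ u v
    unlinked′ uv = unlinked (swapped-linked uv)
    C⁺ : EdgeColouring n k side
    C⁺ = AddEdge.colouring C′ u-v unlinked′ u-free′ v-free′
    within⁺ : Within C⁺
    within⁺ xy with AddEdge.colouring-linked C′ u-v unlinked′ u-free′ v-free′ xy
    ... | inj₁ xy′ = within (swapped-linked xy′)
    ... | inj₂ (inj₁ (refl , refl)) = guv
    ... | inj₂ (inj₂ (refl , refl)) = trans (G-sym v u) guv
    grow : ∀ {x y} → Linked C x y → Linked C⁺ x y
    grow xy = AddEdge.linked-colouring C′ u-v unlinked′ u-free′ v-free′ (linked-swapped xy)

  empty : EdgeColouring n k side
  empty = record
    { mate = λ _ _ → nothing ; mate-sym = λ () ; mate-side = λ () ; mate-injective = λ () }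

  colour-pairs : ∀ (L : List (Fin n × Fin n)) → Σ (EdgeColouring n k side) λ C →
                 Within C × (∀ {x y} → (x , y) ∈ L → G x y ≡ true → Linked C x y)
  colour-pairs [] = empty , (λ ()) , λ ()
  colour-pairs ((u , v) ∷ L) with colour-pairs L
  ... | C , within , covers with G u v in guv
  ... | false = C , within , covers′
    where
    covers′ : ∀ {x y} → (x , y) ∈ (u , v) ∷ L → G x y ≡ true → Linked C x y
    covers′ (here refl) gxy with () ← trans (sym guv) gxy
    covers′ (there xy∈L) gxy = covers xy∈L gxy
  ... | true with extend C within guv
  ... | C′ , within′ , grow , uv = C′ , within′ , covers′
    where
    covers′ : ∀ {x y} → (x , y) ∈ (u , v) ∷ L → G x y ≡ true → Linked C′ x y
    covers′ (here refl) _ = uv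
    covers′ (there xy∈L) gxy = grow (covers xy∈L gxy)

  edge-colouring : ColouringOf k side G
  edge-colouring with colour-pairs (cartesianProduct (allFin n) (allFin n))
  ... | C , within , covers = record
    { colouring = C
    ; linked⇒edge = within
    ; edge⇒linked = λ {x} {y} → covers (∈-cartesianProduct⁺ (∈-allFin x) (∈-allFin y))
    }

-- Balancing the colour classes

module Sides {n} (side : Fin n → Fin 2) where

  onA : Fin n → Bool
  onA x = does (side x ≟ zero)

  onA-side : ∀ {x} → onA x ≡ true → side x ≡ zero
  onA-side = ≟-true

  onA-intro : ∀ {x} → side x ≡ zero → onA x ≡ true
  onA-intro {x} = dec-true (side x ≟ zero)

  onA-false : ∀ {x} → onA x ≡ false → side x ≢ zero
  onA-false {x} A with side x ≟ zero
  ... | no x∉A = x∉A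

  has : ∀ {k} → EdgeColouring n k side → Fin k → Fin n → Bool
  has C γ x = is-just (EdgeColouring.mate C x γ)

  -- the number of γ-edges, each counted at its end on side zero
  size : ∀ {k} → EdgeColouring n k side → Fin k → ℕ
  size C γ = card (λ x → onA x ∧ has C γ x)

module Transfer {n k} {side : Fin n → Fin 2} {G : Fin n → Fin n → Bool}
                (D : ColouringOf k side G) (α β : Fin k) where
  open ColouringOf D
  open AlternatingPath colouring α β zero
  open Sides side

  record Result : Set where
    field
      result : ColouringOf k side G
      size-α : suc (size (ColouringOf.colouring result) α) ≡ size colouring α
      size-β : size (ColouringOf.colouring result) β ≡ suc (size colouring β)
      size-other : ∀ γ → γ ≢ α → γ ≢ β → size (ColouringOf.colouring result) γ ≡ size colouring γ

  Surplus Deficit : Fin n → Bool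
  Surplus x = (onA x ∧ has colouring α x) ∧ not (has colouring β x)
  Deficit x = (onA x ∧ has colouring β x) ∧ not (has colouring α x)

  surplus-spec : ∀ {x} → Surplus x ≡ true →
                 side x ≡ zero × (∃ λ y → mate x α ≡ just y) × mate x β ≡ nothing
  surplus-spec {x} sx with ∧-true {onA x ∧ _} sx
  ... | A∧α , ¬β with ∧-true {onA x} A∧α
  ... | A , α = onA-side A , is-just-true α , is-just-false (not-true ¬β)

  surplus-start : ∀ {x} → Surplus x ≡ true → Start x
  surplus-start sx = let (x∈A , _ , xβ) = surplus-spec sx in trans (cong (mate _) (backward-on x∈A)) xβ

  recolour : (C : EdgeColouring n k side) → (∀ {x y} → Linked C x y → Linked colouring x y) →
             (∀ {x y} → Linked colouring x y → Linked C x y) → ColouringOf k side G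
  recolour C C⊆D D⊆C = record
    { colouring = C
    ; linked⇒edge = λ xy → linked⇒edge (C⊆D xy)
    ; edge⇒linked = λ g → D⊆C (edge⇒linked g)
    }

  -- An alternating path from a surplus vertex that ends on the other side has one
  -- more α-edge than β-edges; swapping it moves one A-vertex from class α to class β.
  module OddPath {x} (sx : Surplus x ≡ true) (odd : side (endVertex x) ≢ zero) where
    open FromStart (surplus-start sx)

    x∈A : side x ≡ zero
    x∈A = proj₁ (surplus-spec sx)

    x-α : mate x α ≡ just (proj₁ (proj₁ (proj₂ (surplus-spec sx))))
    x-α = proj₂ (proj₁ (proj₂ (surplus-spec sx)))

    x-β : mate x β ≡ nothing
    x-β = proj₂ (proj₂ (surplus-spec sx))

    doubly-coloured : ∀ {z} → onPath z ≡ true → z ≢ x → side z ≡ zero → ∀ {γ} → γ ≡ α ⊎ γ ≡ β →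
                      has colouring γ z ≡ true
    doubly-coloured {z} on z≢x z∈A γ∈αβ with onPath-elim on
    ... | zero , refl = ⊥-elim (z≢x refl)
    ... | suc i , w with γ∈αβ
    ... | inj₁ refl = let (_ , zα) = forward-before-end (suc i) w (λ { refl → odd z∈A })
                      in cong is-just (trans (cong (mate z) (sym (forward-on z∈A))) zα)
    ... | inj₂ refl = let (_ , wy , _) = walk-step x i w
                      in cong is-just (trans (cong (mate z) (sym (backward-on z∈A))) (trans (sym (walk-pred x i w)) wy))

    has-preserved : ∀ {z γ} → z ≢ x → side z ≡ zero → γ ≡ α ⊎ γ ≡ β → has swapped γ z ≡ has colouring γ z
    has-preserved {z} {γ} z≢x z∈A γ∈αβ with onPath z in on
    ... | false = refl
    ... | true = trans (doubly-coloured on z≢x z∈A (σ-αβ γ∈αβ)) (sym (doubly-coloured on z≢x z∈A γ∈αβ))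

    agree : ∀ {γ} → γ ≡ α ⊎ γ ≡ β → ∀ z → z ≢ x → (onA z ∧ has colouring γ z) ≡ (onA z ∧ has swapped γ z)
    agree γ∈αβ z z≢x with side z ≟ zero
    ... | yes z∈A = sym (has-preserved z≢x z∈A γ∈αβ)
    ... | no _ = refl

    x-swapped-α : swapMate x α ≡ nothing
    x-swapped-α = trans (swapMate-on α start-onPath) (trans (cong (mate x) (transpose-ˡ α β)) x-β)

    x-swapped-β : swapMate x β ≡ mate x α
    x-swapped-β = trans (swapMate-on β start-onPath) (cong (mate x) (transpose-ʳ α β))

    x-onA : onA x ≡ true
    x-onA = onA-intro x∈A

    result : Result
    result = record
      { result = recolour swapped swapped-linked linked-swapped
      ; size-α = sym (card-differ-at x (agree (inj₁ refl)) (proj₁ (∧-true {onA x ∧ _} sx))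
                   (cong₂ _∧_ x-onA (cong is-just x-swapped-α)))
      ; size-β = card-differ-at x (λ z z≢x → sym (agree (inj₂ refl) z z≢x))
                   (cong₂ _∧_ x-onA (trans (cong is-just x-swapped-β) (cong is-just x-α)))
                   (cong₂ _∧_ x-onA (cong is-just x-β))
      ; size-other = λ γ γ≢α γ≢β → card-cong (λ z → cong (λ m → onA z ∧ is-just m) (swapMate-other z γ≢α γ≢β))
      }

  -- If every alternating path from a surplus vertex ends on side A, it ends at a
  -- deficit vertex, and distinct surplus vertices have distinct path ends.
  surplus-≤-deficit : (∀ {x} → Surplus x ≡ true → side (endVertex x) ≡ zero) → card Surplus ≤ card Deficit
  surplus-≤-deficit even = card-≤-injective endVertex into injective
    where
    into : ∀ x → Surplus x ≡ true → Deficit (endVertex x) ≡ true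
    into x sx = cong₂ _∧_ (cong₂ _∧_ (onA-intro e∈A) e-β) (cong not e-α)
      where
      open FromStart (surplus-start sx)
      e : Fin n
      e = endVertex x
      e∈A : side e ≡ zero
      e∈A = even sx
      e-β : has colouring β e ≡ true
      e-β with surplus-spec sx
      ... | x∈A , (_ , x-α) , _ = let (_ , eβ) = backward-at-end (trans (cong (mate x) (forward-on x∈A)) x-α)
                                  in cong is-just (trans (cong (mate e) (sym (backward-on e∈A))) eβ)
      e-α : has colouring α e ≡ false
      e-α = cong is-just (trans (cong (mate e) (sym (forward-on e∈A))) end-stuck)
    injective : ∀ x x′ → Surplus x ≡ true → Surplus x′ ≡ true → endVertex x ≡ endVertex x′ → x ≡ x′
    injective x x′ sx sx′ same = proj₂ (walks-meet (surplus-start sx) (surplus-start sx′) (endIndex x) (endIndex x′)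
      (FromStart.end-reached (surplus-start sx)) (trans (FromStart.end-reached (surplus-start sx′)) (cong just (sym same))))

  deficit-<-surplus : size colouring β < size colouring α → card Deficit < card Surplus
  deficit-<-surplus β<α = +-cancelˡ-< common (card Deficit) (card Surplus) (subst₂ _<_ size-β size-α β<α)
    where
    common : ℕ
    common = card (λ x → (onA x ∧ has colouring α x) ∧ has colouring β x)
    size-α : size colouring α ≡ common + card Surplus
    size-α = card-∧-split (λ x → onA x ∧ has colouring α x) (has colouring β)
    size-β : size colouring β ≡ common + card Deficit
    size-β = trans (card-∧-split (λ x → onA x ∧ has colouring β x) (has colouring α))
                   (cong (_+ card Deficit) (card-cong (λ x → ∧-swapʳ (onA x) (has colouring β x) (has colouring α x))))

  transfer : size colouring β < size colouring α → Result
  transfer β<α with any? (λ x → (Surplus x ≟ᵇ true) ×-dec ¬? (side (endVertex x) ≟ zero))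
  ... | yes (x , sx , odd) = OddPath.result sx odd
  ... | no no-odd = ⊥-elim (<⇒≱ (deficit-<-surplus β<α) (surplus-≤-deficit even))
    where
    even : ∀ {x} → Surplus x ≡ true → side (endVertex x) ≡ zero
    even {x} sx with side (endVertex x) ≟ zero
    ... | yes e∈A = e∈A
    ... | no odd = ⊥-elim (no-odd (x , sx , odd))

module ClassSizes {n k} {side : Fin n → Fin 2} {G : Fin n → Fin n → Bool}
                  (G-cubic : ∀ x → card (G x) ≡ 3) (D : ColouringOf k side G) where
  open ColouringOf D
  open Sides side

  mate-or-self : Fin n → Fin k → Fin n
  mate-or-self x γ = fromMaybe x (mate x γ)

  colours-at : ∀ x → card (λ γ → has colouring γ x) ≡ 3
  colours-at x = trans (card-≡-bijective (mate-or-self x) into injective surjective) (G-cubic x)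
    where
    into : ∀ γ → has colouring γ x ≡ true → G x (mate-or-self x γ) ≡ true
    into γ _ with mate x γ in xy
    ... | just y = linked⇒edge (γ , xy)
    injective : ∀ γ δ → has colouring γ x ≡ true → has colouring δ x ≡ true →
                mate-or-self x γ ≡ mate-or-self x δ → γ ≡ δ
    injective γ δ _ _ eq with mate x γ in xy | mate x δ in xy′
    ... | just y | just y′ = mate-injective xy (trans xy′ (cong just (sym eq)))
    surjective : ∀ y → G x y ≡ true → ∃ λ γ → has colouring γ x ≡ true × mate-or-self x γ ≡ y
    surjective y gxy = let (γ , xy) = edge⇒linked gxy in γ , cong is-just xy , cong (fromMaybe x) xy

  ∑-class-sizes : ∀ (T : Fin n → Bool) → sum (λ γ → card (λ x → T x ∧ has colouring γ x)) ≡ card T * 3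
  ∑-class-sizes T = begin
    sum (λ γ → card (λ x → T x ∧ has colouring γ x))
      ≡⟨ sum-cong-≗ (λ γ → card-sum (λ x → T x ∧ has colouring γ x)) ⟩
    sum (λ γ → sum (λ x → if T x ∧ has colouring γ x then 1 else 0))
      ≡⟨ ∑-comm (λ γ x → if T x ∧ has colouring γ x then 1 else 0) ⟩
    sum (λ x → sum (λ γ → if T x ∧ has colouring γ x then 1 else 0))
      ≡⟨ sum-cong-≗ at ⟩
    sum (λ x → (if T x then 1 else 0) * 3)
      ≡⟨ *-distribʳ-sum 3 (λ x → if T x then 1 else 0) ⟨
    sum (λ x → if T x then 1 else 0) * 3
      ≡⟨ cong (_* 3) (card-sum T) ⟨
    card T * 3 ∎
    where
    open ≡-Reasoning
    at : ∀ x → sum (λ γ → if T x ∧ has colouring γ x then 1 else 0) ≡ (if T x then 1 else 0) * 3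
    at x with T x
    ... | true = trans (sym (card-sum (λ γ → has colouring γ x))) (colours-at x)
    ... | false = trans (sum-const k 0) (*-zeroʳ k)

  sides-balanced : ∀ γ → card (λ x → onA x ∧ has colouring γ x) ≡ card (λ x → not (onA x) ∧ has colouring γ x)
  sides-balanced γ = card-≡-bijective (λ x → mate-or-self x γ) into injective surjective
    where
    into : ∀ x → (onA x ∧ has colouring γ x) ≡ true → (not (onA (mate-or-self x γ)) ∧ has colouring γ (mate-or-self x γ)) ≡ true
    into x Aγ with ∧-true {onA x} Aγ
    ... | A , _ with mate x γ in xy
    ... | just y rewrite mate-sym xy | dec-false (side y ≟ zero) (λ y∈A → mate-side xy (trans (onA-side A) (sym y∈A))) = refl
    injective : ∀ x x′ → (onA x ∧ has colouring γ x) ≡ true → (onA x′ ∧ has colouring γ x′) ≡ true →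
                mate-or-self x γ ≡ mate-or-self x′ γ → x ≡ x′
    injective x x′ Aγ Aγ′ eq with ∧-true {onA x} Aγ | ∧-true {onA x′} Aγ′
    ... | _ , hx | _ , hx′ with is-just-true hx | is-just-true hx′
    ... | y , xy | y′ , x′y′ = just-injective (trans (sym (mate-sym xy)) (trans (cong (λ z → mate z γ) y≡y′) (mate-sym x′y′)))
      where
      y≡y′ : y ≡ y′
      y≡y′ = trans (sym (cong (fromMaybe x) xy)) (trans eq (cong (fromMaybe x′) x′y′))
    surjective : ∀ y → (not (onA y) ∧ has colouring γ y) ≡ true → ∃ λ x → (onA x ∧ has colouring γ x) ≡ true × mate-or-self x γ ≡ y
    surjective y Bγ with ∧-true {not (onA y)} Bγ
    ... | B , hy with is-just-true hy
    ... | x , yx = x , cong₂ _∧_ (onA-intro x∈A) (cong is-just (mate-sym yx)) , cong (fromMaybe x) (mate-sym yx)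
      where
      x∈A : side x ≡ zero
      x∈A = fin2-≢-≢ (λ eq → mate-side yx (sym eq)) (λ eq → onA-false (not-true B) (sym eq))

module Balance {m} {side : Fin (2 * m) → Fin 2} {G : Fin (2 * m) → Fin (2 * m) → Bool}
               (G-cubic : ∀ x → card (G x) ≡ 3) where
  open Sides side

  sizes : ColouringOf m side G → Fin m → ℕ
  sizes D = size (ColouringOf.colouring D)

  Equitable : ColouringOf m side G → Set
  Equitable D = ∀ γ → sizes D γ ≡ 3

  ∑-sizes : ∀ D → sum (sizes D) ≡ m * 3
  ∑-sizes D = trans (∑-class-sizes onA) (cong (_* 3) |A|≡m)
    where
    open ClassSizes G-cubic D
    |A|≡|B| : card onA ≡ card (λ x → not (onA x))
    |A|≡|B| = *-cancelʳ-≡ _ _ 3 (trans (sym (∑-class-sizes onA))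
                (trans (sum-cong-≗ sides-balanced) (∑-class-sizes (λ x → not (onA x)))))
    |A|≡m : card onA ≡ m
    |A|≡m = *-cancelˡ-≡ _ m 2 (trans (cong (card onA +_) (+-identityʳ (card onA)))
              (trans (cong (card onA +_) |A|≡|B|) (card-not onA)))

  excess : ColouringOf m side G → ℕ
  excess D = sum (λ γ → sizes D γ ∸ 3)

  balance-step : ∀ D {α β} → 3 < sizes D α → sizes D β < 3 →
                 Σ (ColouringOf m side G) λ D′ → excess D′ < excess D
  balance-step D {α} {β} large small = D′ , sum-mono-< pointwise α strict
    where
    open Transfer.Result (Transfer.transfer D α β (<-trans small large)) renaming (result to D′)
    pointwise : ∀ γ → sizes D′ γ ∸ 3 ≤ sizes D γ ∸ 3
    pointwise γ with γ ≟ α | γ ≟ β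
    ... | yes refl | _ = ∸-monoˡ-≤ 3 (subst (sizes D′ α ≤_) size-α (n≤1+n _))
    ... | no _ | yes refl = subst (_≤ sizes D β ∸ 3) (sym (m≤n⇒m∸n≡0 (subst (_≤ 3) (sym size-β) small))) z≤n
    ... | no γ≢α | no γ≢β = ≤-reflexive (cong (_∸ 3) (size-other γ γ≢α γ≢β))
    3≤size′ : 3 ≤ sizes D′ α
    3≤size′ = ≤-pred (subst (3 <_) (sym size-α) large)
    strict : sizes D′ α ∸ 3 < sizes D α ∸ 3
    strict = subst (sizes D′ α ∸ 3 <_) (trans (sym (+-∸-assoc 1 3≤size′)) (cong (_∸ 3) size-α)) ≤-refl

  balance : ColouringOf m side G → Σ (ColouringOf m side G) Equitable
  balance D = <-rec (λ e → ∀ D → excess D ≡ e → Σ (ColouringOf m side G) Equitable) step (excess D) D refl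
    where
    step : ∀ e → (∀ {e′} → e′ < e → ∀ D → excess D ≡ e′ → Σ (ColouringOf m side G) Equitable) →
           ∀ D → excess D ≡ e → Σ (ColouringOf m side G) Equitable
    step _ rec D refl with any? (λ γ → 3 <? sizes D γ)
    ... | no no-large = D , sum-≤-tight (λ γ → ≮⇒≥ (λ large → no-large (γ , large))) (∑-sizes D)
    ... | yes (α , large) with any? (λ γ → sizes D γ <? 3)
    ... | no no-small = ⊥-elim (<-irrefl (sym (∑-sizes D))
                          (const-<-sum (λ γ → ≮⇒≥ (λ small → no-small (γ , small))) α large))
    ... | yes (β , small) = let (D′ , decreases) = balance-step D large small in rec decreases D′ refl

-- The configuration

-- A partition of the edges of G into m matchings of three edges each.
record Equipartition {n} (m : ℕ) (side : Fin n → Fin 2) (G : Fin n → Fin n → Bool) : Set where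
  field
    endpoint : Fin 3 → Fin m → Fin 2 → Fin n
    endpoint-side : ∀ t k s → side (endpoint t k s) ≡ s
    endpoint-edge : ∀ t k → G (endpoint t k zero) (endpoint t k (suc zero)) ≡ true
    edge-endpoints : ∀ {x y} → G x y ≡ true → ∃₂ λ t k → endpoint t k (side x) ≡ x × endpoint t k (side y) ≡ y
    endpoint-injective : ∀ {t t′ k} s → endpoint t k s ≡ endpoint t′ k s → t ≡ t′
    endpoints-injective : ∀ {t t′ k k′} → (∀ s → endpoint t k s ≡ endpoint t′ k′ s) → t ≡ t′ × k ≡ k′

module FromEquitable {n m} {side : Fin n → Fin 2} {G : Fin n → Fin n → Bool} (D : ColouringOf m side G)
                     (equitable : ∀ γ → Sides.size side (ColouringOf.colouring D) γ ≡ 3) where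
  open ColouringOf D
  open Sides side

  class : Fin m → Fin n → Bool
  class k x = onA x ∧ has colouring k x

  module E k = Enumeration (subst (Enumeration (class k)) (equitable k) (enumerate (class k)))

  head tail : Fin 3 → Fin m → Fin n
  head t k = E.enum k t
  tail t k = fromMaybe (head t k) (mate (head t k) k)

  head-∈ : ∀ t k → onA (head t k) ≡ true × has colouring k (head t k) ≡ true
  head-∈ t k = ∧-true (E.enum-∈ k t)

  head-tail : ∀ t k → mate (head t k) k ≡ just (tail t k)
  head-tail t k with mate (head t k) k | proj₂ (head-∈ t k)
  ... | just y | _ = refl

  endpoint : Fin 3 → Fin m → Fin 2 → Fin n
  endpoint t k zero = head t k
  endpoint t k (suc zero) = tail t k

  endpoint-side : ∀ t k s → side (endpoint t k s) ≡ s
  endpoint-side t k zero = onA-side (proj₁ (head-∈ t k))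
  endpoint-side t k (suc zero) =
    fin2-opposite (λ eq → mate-side (head-tail t k) (trans (endpoint-side t k zero) (sym eq)))

  edge-from-A : ∀ {a c k} → side a ≡ zero → mate a k ≡ just c →
                ∃ λ t → endpoint t k zero ≡ a × endpoint t k (suc zero) ≡ c
  edge-from-A {a} {c} {k} a∈A ac = t , head≡a , just-injective (trans (sym (head-tail t k)) (trans (cong (λ x → mate x k) head≡a) ac))
    where
    a∈class : class k a ≡ true
    a∈class = cong₂ _∧_ (onA-intro a∈A) (cong is-just ac)
    t = E.index k a a∈class
    head≡a = E.enum-index k a a∈class

  edge-endpoints : ∀ {x y} → G x y ≡ true → ∃₂ λ t k → endpoint t k (side x) ≡ x × endpoint t k (side y) ≡ y
  edge-endpoints {x} {y} gxy with edge⇒linked gxy | side x ≟ zero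
  ... | k , xy | yes x∈A = let (t , ex , ey) = edge-from-A x∈A xy in
    t , k , subst (λ s → endpoint t k s ≡ x) (sym x∈A) ex ,
            subst (λ s → endpoint t k s ≡ y) (sym (fin2-opposite (λ y∈A → mate-side xy (trans x∈A (sym y∈A))))) ey
  ... | k , xy | no x∉A = let (t , ey , ex) = edge-from-A y∈A (mate-sym xy) in
    t , k , subst (λ s → endpoint t k s ≡ x) (sym (fin2-opposite x∉A)) ex ,
            subst (λ s → endpoint t k s ≡ y) (sym y∈A) ey
    where
    y∈A : side y ≡ zero
    y∈A = fin2-≢-≢ (λ eq → mate-side xy (sym eq)) (λ eq → x∉A (sym eq))

  heads-injective : ∀ {t t′ k} → head t k ≡ head t′ k → t ≡ t′
  heads-injective {t} {t′} {k} = E.enum-injective k t t′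

  endpoint-injective : ∀ {t t′ k} s → endpoint t k s ≡ endpoint t′ k s → t ≡ t′
  endpoint-injective zero eq = heads-injective eq
  endpoint-injective {t} {t′} {k} (suc zero) eq = heads-injective (just-injective
    (trans (sym (mate-sym (head-tail t k))) (trans (cong (λ y → mate y k) eq) (mate-sym (head-tail t′ k)))))

  endpoints-injective : ∀ {t t′ k k′} → (∀ s → endpoint t k s ≡ endpoint t′ k′ s) → t ≡ t′ × k ≡ k′
  endpoints-injective {t} {t′} {k} {k′} same with mate-injective (head-tail t k)
    (trans (cong (λ x → mate x k′) (same zero)) (trans (head-tail t′ k′) (cong just (sym (same (suc zero))))))
  ... | refl = heads-injective (same zero) , refl

  equipartition : Equipartition m side G
  equipartition = record
    { endpoint = endpoint
    ; endpoint-side = endpoint-side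
    ; endpoint-edge = λ t k → linked⇒edge (k , head-tail t k)
    ; edge-endpoints = edge-endpoints
    ; endpoint-injective = endpoint-injective
    ; endpoints-injective = endpoints-injective
    }

module Construction {m} {side : Fin (2 * m) → Fin 2} (Γ : Graph (2 * m))
                    (Γ-side : ∀ {x y} → E Γ x y ≡ true → side x ≢ side y) (Γ-cubic : Cubic Γ)
                    (P : Equipartition m side (E Γ)) where
  open Equipartition P

  -- The points are the m new points followed by the vertices of Γ; block (t , k)
  -- consists of the ends of edge t of matching k together with the new point k.
  Point : Set
  Point = Fin m ⊎ Fin (2 * m)

  Block : Set
  Block = Fin 3 × Fin m

  ends : Block → Fin 2 → Fin (2 * m)
  ends (t , k) = endpoint t k

  point : Point → Fin (3 * m)
  point = join m (2 * m)

  block : Block → Fin (3 * m)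
  block = uncurry combine

  Incident : Point → Block → Bool
  Incident (inj₁ w) (_ , k) = does (w ≟ k)
  Incident (inj₂ x) c = does (x ≟ ends c (side x))

  incidence : Fin (3 * m) → Fin (3 * m) → Bool
  incidence p b = Incident (splitAt m p) (remQuot m b)

  point-injective : ∀ {z z′} → point z ≡ point z′ → z ≡ z′
  point-injective {z} {z′} eq = trans (sym (splitAt-join m _ z)) (trans (cong (splitAt m) eq) (splitAt-join m _ z′))

  block-remQuot : ∀ b → block (remQuot m b) ≡ b
  block-remQuot = combine-remQuot m

  incidence-point : ∀ z b → incidence (point z) b ≡ Incident z (remQuot m b)
  incidence-point z b = cong (λ z′ → Incident z′ (remQuot m b)) (splitAt-join m _ z)

  incidence-block : ∀ p c → incidence p (block c) ≡ Incident (splitAt m p) c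
  incidence-block p (t , k) = cong (Incident (splitAt m p)) (remQuot-combine t k)

  member : Block → Fin 3 → Point
  member (t , k) zero = inj₂ (endpoint t k zero)
  member (t , k) (suc zero) = inj₂ (endpoint t k (suc zero))
  member (t , k) (suc (suc zero)) = inj₁ k

  colour : Point → Fin 3
  colour (inj₁ _) = suc (suc zero)
  colour (inj₂ x) = inject₁ (side x)

  colour-member : ∀ c i → colour (member c i) ≡ i
  colour-member (t , k) zero = cong inject₁ (endpoint-side t k zero)
  colour-member (t , k) (suc zero) = cong inject₁ (endpoint-side t k (suc zero))
  colour-member (t , k) (suc (suc zero)) = refl

  member-injective : ∀ c {i j} → member c i ≡ member c j → i ≡ j
  member-injective c {i} {j} eq = trans (sym (colour-member c i)) (trans (cong colour eq) (colour-member c j))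

  endpoint-incident : ∀ t k s → Incident (inj₂ (endpoint t k s)) (t , k) ≡ true
  endpoint-incident t k s = dec-true (_ ≟ _) (cong (endpoint t k) (sym (endpoint-side t k s)))

  member-incident : ∀ c i → Incident (member c i) c ≡ true
  member-incident (t , k) zero = endpoint-incident t k zero
  member-incident (t , k) (suc zero) = endpoint-incident t k (suc zero)
  member-incident (t , k) (suc (suc zero)) = dec-true (k ≟ k) refl

  member-surjective : ∀ c z → Incident z c ≡ true → ∃ λ i → member c i ≡ z
  member-surjective (t , k) (inj₁ w) inc = suc (suc zero) , cong inj₁ (sym (≟-true inc))
  member-surjective (t , k) (inj₂ x) inc with side x | ≟-true {a = x} inc
  ... | zero | x≡e = zero , cong inj₂ (sym x≡e)
  ... | suc zero | x≡e = suc zero , cong inj₂ (sym x≡e)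

  incident-vertex : ∀ {x} c → Incident (inj₂ x) c ≡ true → ends c (side x) ≡ x
  incident-vertex {x} _ inc = sym (≟-true {a = x} inc)

  co-incident-sides : ∀ {x y} c → x ≢ y → Incident (inj₂ x) c ≡ true → Incident (inj₂ y) c ≡ true →
                      side y ≡ opposite (side x)
  co-incident-sides {x} {y} c x≢y inc₁ inc₂ = fin2-opposite λ eq →
    x≢y (trans (sym (incident-vertex c inc₁)) (trans (cong (ends c) (sym eq)) (incident-vertex c inc₂)))

  incidence-members : ∀ p b → incidence p b ≡ true → ∃ λ i → point (member (remQuot m b) i) ≡ p
  incidence-members p b inc = let (i , eq) = member-surjective (remQuot m b) (splitAt m p) inc
                              in i , trans (cong point eq) (join-splitAt m _ p)

  block-card : ∀ b → card (λ p → incidence p b) ≡ 3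
  block-card b = sym (card-≡-bijective (λ i → point (member c i)) into injective surjective)
    where
    c : Block
    c = remQuot m b
    into : ∀ i → true ≡ true → incidence (point (member c i)) b ≡ true
    into i _ = trans (incidence-point (member c i) b) (member-incident c i)
    injective : ∀ i j → true ≡ true → true ≡ true → point (member c i) ≡ point (member c j) → i ≡ j
    injective i j _ _ eq = member-injective c (point-injective eq)
    surjective : ∀ p → incidence p b ≡ true → ∃ λ i → true ≡ true × point (member c i) ≡ p
    surjective p inc = let (i , eq) = incidence-members p b inc in i , refl , eq

  endpoint-adjacent : ∀ t k s → E Γ (endpoint t k s) (endpoint t k (opposite s)) ≡ true
  endpoint-adjacent t k zero = endpoint-edge t k
  endpoint-adjacent t k (suc zero) = trans (Graph.sym Γ _ _) (endpoint-edge t k)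

  -- A vertex x lies in one block per edge at x, and the block of an edge is determined
  -- by the edge's end opposite to x.
  vertex-degree : ∀ x → card (λ b → Incident (inj₂ x) (remQuot m b)) ≡ 3
  vertex-degree x = trans (card-≡-bijective neighbour into injective surjective) (Γ-cubic x)
    where
    neighbour : Fin (3 * m) → Fin (2 * m)
    neighbour b = ends (remQuot m b) (opposite (side x))
    into : ∀ b → Incident (inj₂ x) (remQuot m b) ≡ true → E Γ x (neighbour b) ≡ true
    into b inc = subst (λ y → E Γ y (neighbour b) ≡ true) (incident-vertex (remQuot m b) inc) (endpoint-adjacent _ _ (side x))
    injective : ∀ b b′ → Incident (inj₂ x) (remQuot m b) ≡ true → Incident (inj₂ x) (remQuot m b′) ≡ true →
                neighbour b ≡ neighbour b′ → b ≡ b′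
    injective b b′ inc inc′ eq = trans (sym (block-remQuot b)) (trans (cong block same) (block-remQuot b′))
      where
      agree : ∀ s → ends (remQuot m b) s ≡ ends (remQuot m b′) s
      agree s with fin2-cover (side x) s
      ... | inj₁ refl = trans (incident-vertex (remQuot m b) inc) (sym (incident-vertex (remQuot m b′) inc′))
      ... | inj₂ refl = eq
      same : remQuot m b ≡ remQuot m b′
      same = let (t≡t′ , k≡k′) = endpoints-injective agree in cong₂ _,_ t≡t′ k≡k′
    surjective : ∀ y → E Γ x y ≡ true → ∃ λ b → Incident (inj₂ x) (remQuot m b) ≡ true × neighbour b ≡ y
    surjective y xy with edge-endpoints xy
    ... | t , k , ex , ey = block (t , k) ,
      subst (λ c → Incident (inj₂ x) c ≡ true) (sym (remQuot-combine t k)) (dec-true (x ≟ _) (sym ex)) ,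
      trans (cong (λ c → ends c (opposite (side x))) (remQuot-combine t k))
            (trans (cong (endpoint t k) (sym (fin2-opposite (Γ-side (trans (Graph.sym Γ y x) xy))))) ey)

  new-point-degree : ∀ w → card (λ b → Incident (inj₁ w) (remQuot m b)) ≡ 3
  new-point-degree w = sym (card-≡-bijective (λ t → block (t , w)) into injective surjective)
    where
    into : ∀ t → true ≡ true → Incident (inj₁ w) (remQuot m (block (t , w))) ≡ true
    into t _ = trans (cong (Incident (inj₁ w)) (remQuot-combine t w)) (dec-true (w ≟ w) refl)
    injective : ∀ t t′ → true ≡ true → true ≡ true → block (t , w) ≡ block (t′ , w) → t ≡ t′
    injective t t′ _ _ eq = proj₁ (combine-injective t w t′ w eq)
    surjective : ∀ b → Incident (inj₁ w) (remQuot m b) ≡ true → ∃ λ t → true ≡ true × block (t , w) ≡ b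
    surjective b inc = proj₁ (remQuot m b) , refl ,
      trans (cong (λ k → block (proj₁ (remQuot m b) , k)) (≟-true inc)) (block-remQuot b)

  point-card : ∀ p → card (λ b → incidence p b) ≡ 3
  point-card p with splitAt m p
  ... | inj₁ w = new-point-degree w
  ... | inj₂ x = vertex-degree x

  -- Two distinct points determine the block containing them: two vertices are the
  -- ends of its edge, and a new point k together with a vertex fix its matching and
  -- the edge of that matching at the vertex.
  block-unique : ∀ {z z′} → z ≢ z′ → ∀ c c′ → Incident z c ≡ true → Incident z′ c ≡ true →
                 Incident z c′ ≡ true → Incident z′ c′ ≡ true → c ≡ c′
  block-unique {inj₁ w} {inj₁ w′} z≢z′ _ _ inc₁ inc₂ _ _ =
    ⊥-elim (z≢z′ (cong inj₁ (trans (≟-true inc₁) (sym (≟-true inc₂)))))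
  block-unique {inj₁ w} {inj₂ x} _ (t , k) (t′ , k′) inc₁ inc₂ inc₃ inc₄
    with trans (sym (≟-true {a = w} inc₁)) (≟-true {a = w} inc₃)
  ... | refl = cong (_, k) (endpoint-injective (side x) (trans (sym (≟-true {a = x} inc₂)) (≟-true {a = x} inc₄)))
  block-unique {inj₂ x} {inj₁ w} z≢z′ c c′ inc₁ inc₂ inc₃ inc₄ =
    block-unique (λ eq → z≢z′ (sym eq)) c c′ inc₂ inc₁ inc₄ inc₃
  block-unique {inj₂ x} {inj₂ y} z≢z′ (t , k) (t′ , k′) inc₁ inc₂ inc₃ inc₄ =
    let (t≡t′ , k≡k′) = endpoints-injective agree in cong₂ _,_ t≡t′ k≡k′
    where
    agree : ∀ s → endpoint t k s ≡ endpoint t′ k′ s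
    agree s with fin2-cover (side x) s
    ... | inj₁ refl = trans (incident-vertex (t , k) inc₁) (sym (incident-vertex (t′ , k′) inc₃))
    ... | inj₂ refl = subst (λ r → endpoint t k r ≡ endpoint t′ k′ r)
                            (co-incident-sides (t , k) (λ eq → z≢z′ (cong inj₂ eq)) inc₁ inc₂)
                            (trans (incident-vertex (t , k) inc₂) (sym (incident-vertex (t′ , k′) inc₄)))

  configuration : Config (3 * m)
  configuration = record
    { inc = incidence
    ; block-size = block-card
    ; point-deg = point-card
    ; pair-once = pair-card
    }
    where
    pair-card : ∀ p q → p ≢ q → ∀ b b′ → incidence p b ≡ true → incidence q b ≡ true →
                incidence p b′ ≡ true → incidence q b′ ≡ true → b ≡ b′
    pair-card p q p≢q b b′ inc₁ inc₂ inc₃ inc₄ = begin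
      b                      ≡⟨ block-remQuot b ⟨
      block (remQuot m b)    ≡⟨ cong block (block-unique {splitAt m p} {splitAt m q} views-differ _ _ inc₁ inc₂ inc₃ inc₄) ⟩
      block (remQuot m b′)   ≡⟨ block-remQuot b′ ⟩
      b′                     ∎
      where
      open ≡-Reasoning
      views-differ : splitAt m p ≢ splitAt m q
      views-differ eq = p≢q (trans (sym (join-splitAt m _ p)) (trans (cong point eq) (join-splitAt m _ q)))

  col : Fin (3 * m) → Fin 3
  col p = colour (splitAt m p)

  col-member : ∀ c i → col (point (member c i)) ≡ i
  col-member c i = trans (cong colour (splitAt-join m _ (member c i))) (colour-member c i)

  strong-colouring : StrongColouring configuration 3 col
  strong-colouring p q (p≢q , b , inc₁ , inc₂) same with incidence-members p b inc₁ | incidence-members q b inc₂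
  ... | i , refl | j , refl = p≢q (cong (λ i → point (member (remQuot m b) i))
          (trans (sym (col-member _ i)) (trans same (col-member _ j))))

  block-incidence : ∀ c i → incidence (point (member c i)) (block c) ≡ true
  block-incidence c i = trans (incidence-block _ c) (trans (cong (λ z → Incident z c) (splitAt-join m _ (member c i))) (member-incident c i))

  -- Any colouring with fewer than three colours repeats a colour on the three
  -- pairwise adjacent points of a block.
  no-fewer-colours : Fin m → ∀ j → j < 3 → ¬ (∃ λ (c : Fin (3 * m) → Fin j) → StrongColouring configuration j c)
  no-fewer-colours k₀ j j<3 (c , strong) with pigeonhole j<3 (λ i → c (point (member b₀ i)))
    where b₀ = (zero , k₀)
  ... | i , i′ , i<i′ , same = strong _ _ (distinct , block (zero , k₀) , block-incidence _ i , block-incidence _ i′) same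
    where
    distinct : point (member (zero , k₀) i) ≢ point (member (zero , k₀) i′)
    distinct eq = <⇒≢ i<i′ (member-injective (zero , k₀) (point-injective eq))

  chromatic : Fin m → StrongChromatic configuration 3
  chromatic k₀ = (col , strong-colouring) , no-fewer-colours k₀

  vertex : Fin (2 * m) → Fin (3 * m)
  vertex x = point (inj₂ x)

  induced : IsoToInduced Γ configuration (λ p → col p ≢ suc (suc zero))
  induced = vertex , (λ eq → inj₂-injective (point-injective eq)) , vertex-colour , onto , λ x y → mk⇔ (to x y) (from x y)
    where
    vertex-colour : ∀ x → col (vertex x) ≢ suc (suc zero)
    vertex-colour x rewrite splitAt-join m _ (inj₂ {A = Fin m} x) with side x
    ... | zero = λ ()
    ... | suc zero = λ ()
    onto : ∀ p → col p ≢ suc (suc zero) → ∃ λ x → vertex x ≡ p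
    onto p not-new with splitAt m p in eq
    ... | inj₁ _ = ⊥-elim (not-new refl)
    ... | inj₂ x = x , trans (cong point (sym eq)) (join-splitAt m _ p)
    to : ∀ x y → E Γ x y ≡ true → Adj configuration (vertex x) (vertex y)
    to x y xy with edge-endpoints xy
    ... | t , k , ex , ey = (λ eq → Γ-side xy (cong side (inj₂-injective (point-injective eq)))) , block (t , k) ,
      trans (incidence-point (inj₂ x) _) (trans (cong (Incident (inj₂ x)) (remQuot-combine t k)) (dec-true (x ≟ _) (sym ex))) ,
      trans (incidence-point (inj₂ y) _) (trans (cong (Incident (inj₂ y)) (remQuot-combine t k)) (dec-true (y ≟ _) (sym ey)))
    from : ∀ x y → Adj configuration (vertex x) (vertex y) → E Γ x y ≡ true
    from x y (x≢y , b , inc₁ , inc₂) = subst₂ (λ u v → E Γ u v ≡ true) (incident-vertex c inc₁′)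
      (trans (cong (ends c) (sym (co-incident-sides c (λ eq → x≢y (cong vertex eq)) inc₁′ inc₂′)))
             (incident-vertex c inc₂′))
      (endpoint-adjacent (proj₁ c) (proj₂ c) (side x))
      where
      c : Block
      c = remQuot m b
      inc₁′ : Incident (inj₂ x) c ≡ true
      inc₁′ = trans (sym (incidence-point (inj₂ x) b)) inc₁
      inc₂′ : Incident (inj₂ y) c ≡ true
      inc₂′ = trans (sym (incidence-point (inj₂ y) b)) inc₂

theorem18 : (m : ℕ) → 3 ≤ m → (Γ : Graph (2 * m)) → Cubic Γ → Bipartite Γ →
    Σ (Config (3 * m)) λ X → StrongChromatic X 3 ×
      (∃ λ (c : Fin (3 * m) → Fin 3) → StrongColouring X 3 c ×
        IsoToInduced Γ X (λ p → c p ≢ suc (suc zero)))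
theorem18 m 3≤m Γ cubic (side , bipartite) =
  configuration , chromatic (fromℕ< (≤-trans (s≤s z≤n) 3≤m)) , col , strong-colouring , induced
  where
  proper : ColouringOf m side (E Γ)
  proper = König.edge-colouring (E Γ) side (Graph.sym Γ) (bipartite _ _) (λ x → subst (_≤ m) (sym (cubic x)) 3≤m)
  equitable : Σ (ColouringOf m side (E Γ)) (Balance.Equitable cubic)
  equitable = Balance.balance cubic proper
  open Construction Γ (bipartite _ _) cubic (FromEquitable.equipartition (proj₁ equitable) (proj₂ equitable))
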